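{- Every arc-colored tournament in which every triangle is rainbow has a kernel by rainbow paths.
   Context: All digraphs are finite and simple; paths and cycles are directed. A tournament is an orientation of a complete graph. A triangle is a directed cycle of length 3. An arc-colored digraph has each arc assigned a color. A path (or cycle) is rainbow if any two of its arcs receive distinct colors. A kernel by rainbow paths of an arc-colored digraph $D$ is a set $S\subseteq V(D)$ such that (i) no two vertices of $S$ are connected by a rainbow path in $D$, and (ii) every vertex of $V(D)\setminus S$ can reach some vertex of $S$ by a rainbow path in $D$. -}

module Defs where

open import Data.Nat using (ℕ)
open import Data.Fin using (Fin)
open import Data.Bool using (Bool; true; false)
open import Data.List using (List; []; _∷_)
open import Data.List.Relation.Unary.Unique.Propositional using (Unique)
open import Data.Product using (_×_; ∃-syntax)
open import Relation.Binary.PropositionalEquality using (_≡_; _≢_)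
open import Relation.Nullary using (¬_)

Digraph : ℕ → Set
Digraph n = Fin n → Fin n → Bool

IsTournament : {n : ℕ} → Digraph n → Set
IsTournament {n} D =
  ((u : Fin n) → D u u ≡ false) ×
  ((u v : Fin n) → u ≢ v → D u v ≢ D v u)

-- An arc colouring (only its values on arcs matter). Colours are natural
-- numbers; since the digraph is finite this loses no generality.
Colouring : ℕ → Set
Colouring n = Fin n → Fin n → ℕ

data Walk {n : ℕ} (D : Digraph n) : Fin n → Fin n → Set where
  arc  : {u v : Fin n} → D u v ≡ true → Walk D u v
  _∷ʷ_ : {u w v : Fin n} → D u w ≡ true → Walk D w v → Walk D u v

vertices : {n : ℕ} {D : Digraph n} {u v : Fin n} → Walk D u v → List (Fin n)
vertices {u = u} {v = v} (arc _) = u ∷ v ∷ []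
vertices {u = u} (_ ∷ʷ w) = u ∷ vertices w

arcColours : {n : ℕ} {D : Digraph n} → Colouring n → {u v : Fin n} →
             Walk D u v → List ℕ
arcColours c {u} {v} (arc _) = c u v ∷ []
arcColours c {u} (_∷ʷ_ {w = w} _ p) = c u w ∷ arcColours c p

IsPath : {n : ℕ} {D : Digraph n} {u v : Fin n} → Walk D u v → Set
IsPath p = Unique (vertices p)

IsRainbow : {n : ℕ} {D : Digraph n} → Colouring n → {u v : Fin n} →
            Walk D u v → Set
IsRainbow c p = Unique (arcColours c p)

RainbowPath : {n : ℕ} → Digraph n → Colouring n → Fin n → Fin n → Set
RainbowPath D c u v = ∃[ p ] (IsPath {D = D} {u} {v} p × IsRainbow c p)

TrianglesRainbow : {n : ℕ} → Digraph n → Colouring n → Set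
TrianglesRainbow {n} D c =
  (u v w : Fin n) → D u v ≡ true → D v w ≡ true → D w u ≡ true →
  (c u v ≢ c v w) × (c v w ≢ c w u) × (c u v ≢ c w u)

IsKernelByRainbowPaths : {n : ℕ} → Digraph n → Colouring n →
                         (Fin n → Bool) → Set
IsKernelByRainbowPaths {n} D c S =
  ((u v : Fin n) → S u ≡ true → S v ≡ true → ¬ RainbowPath D c u v) ×
  ((u : Fin n) → S u ≡ false → ∃[ v ] (S v ≡ true × RainbowPath D c u v))

-- A vertex v of maximum in-degree in a tournament is an in-king: if v → u, then
-- u → w → v for some w, since otherwise every in-neighbour of v would also be an
-- in-neighbour of u, and so would v itself, giving u a larger in-degree. The
-- path u → w → v closes the triangle u → w → v → u, which is rainbow by
-- hypothesis, so every other vertex reaches v by a rainbow path of length at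
-- most two, and {v} is a kernel by rainbow paths.
module Submission where

open import Defs
open import Data.Nat using (ℕ; zero; suc; _≤_)
open import Data.Nat.Properties using (<⇒≱)
open import Data.Fin using (Fin; zero; _≟_)
open import Data.Fin.Properties using (any?)
open import Data.Fin.Subset using (Subset; _∈_; _⊂_; ∣_∣)
open import Data.Fin.Subset.Properties using (p⊂q⇒∣p∣<∣q∣)
open import Data.Bool using (true; false; not)
open import Data.Bool.Properties using (¬-not) renaming (_≟_ to _≟ᵇ_)
open import Data.Vec using (tabulate)
open import Data.Vec.Properties using (lookup∘tabulate; lookup⇒[]=; []=⇒lookup)
open import Data.List using ([]; _∷_; allFin)
open import Data.List.Extrema.Nat using (argmax; f[xs]≤f[argmax])
open import Data.List.Membership.Propositional.Properties using (∈-allFin)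
open import Data.List.Relation.Unary.All as All using (All; []; _∷_)
open import Data.List.Relation.Unary.AllPairs using ([]; _∷_)
open import Data.Product using (∃-syntax; _,_; _×_; proj₁; proj₂)
open import Data.Empty using (⊥-elim)
open import Relation.Binary.PropositionalEquality using (_≡_; _≢_; refl; sym; trans; cong; ≢-sym)
open import Relation.Nullary using (¬_; yes; no; does; contradiction)
open import Relation.Nullary.Decidable using (_×-dec_; dec-true)

private
  variable
    n : ℕ
    D : Digraph n
    u v w : Fin n

inNeighbours : Digraph n → Fin n → Subset n
inNeighbours D v = tabulate (λ x → D x v)

inDegree : Digraph n → Fin n → ℕ
inDegree D v = ∣ inNeighbours D v ∣

∈-inNeighbours⁺ : (D : Digraph n) → D u v ≡ true → u ∈ inNeighbours D v
∈-inNeighbours⁺ {u = u} {v} D duv =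
  lookup⇒[]= u _ (trans (lookup∘tabulate (λ x → D x v) u) duv)

∈-inNeighbours⁻ : (D : Digraph n) → u ∈ inNeighbours D v → D u v ≡ true
∈-inNeighbours⁻ {u = u} {v} D u∈ =
  trans (sym (lookup∘tabulate (λ x → D x v) u)) ([]=⇒lookup u∈)

maxInDegree : (D : Digraph (suc n)) → ∃[ v ] (∀ u → inDegree D u ≤ inDegree D v)
maxInDegree D =
  argmax (inDegree D) zero (allFin _) ,
  λ u → All.lookup (f[xs]≤f[argmax] {f = inDegree D} zero (allFin _)) (∈-allFin u)

All-vertices⇒target : {P : Fin n → Set} (p : Walk D u v) → All P (vertices p) → P v
All-vertices⇒target (arc _)   (_ ∷ Pv ∷ []) = Pv
All-vertices⇒target (_ ∷ʷ p) (_ ∷ Ps)      = All-vertices⇒target p Ps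

path-endpoints-distinct : (p : Walk D u v) → IsPath p → u ≢ v
path-endpoints-distinct (arc _)   ((u≢v ∷ []) ∷ _) = u≢v
path-endpoints-distinct (_ ∷ʷ p) (u≢rest ∷ _)     = All-vertices⇒target p u≢rest

arc⇒rainbowPath : (c : Colouring n) → u ≢ v → D u v ≡ true → RainbowPath D c u v
arc⇒rainbowPath c u≢v duv = arc duv , (u≢v ∷ []) ∷ [] ∷ [] , [] ∷ []

twoArcs⇒rainbowPath : (c : Colouring n) → u ≢ w → w ≢ v → u ≢ v → c u w ≢ c w v →
                      D u w ≡ true → D w v ≡ true → RainbowPath D c u v
twoArcs⇒rainbowPath c u≢w w≢v u≢v cuw≢cwv duw dwv =
  duw ∷ʷ arc dwv ,
  (u≢w ∷ u≢v ∷ []) ∷ (w≢v ∷ []) ∷ [] ∷ [] ,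
  (cuw≢cwv ∷ []) ∷ [] ∷ []

singleton-isKernelByRainbowPaths : (c : Colouring n) (v : Fin n) →
  (∀ u → u ≢ v → RainbowPath D c u v) →
  IsKernelByRainbowPaths D c (λ x → does (x ≟ v))
singleton-isKernelByRainbowPaths {D = D} c v reach = independent , absorbing
  where
  independent : ∀ a b → does (a ≟ v) ≡ true → does (b ≟ v) ≡ true → ¬ RainbowPath D c a b
  independent a b _ _ (p , p-path , _) with a ≟ v | b ≟ v
  ... | yes refl | yes refl = path-endpoints-distinct p p-path refl

  absorbing : ∀ u → does (u ≟ v) ≡ false → ∃[ x ] (does (x ≟ v) ≡ true × RainbowPath D c u x)
  absorbing u _ with u ≟ v
  ... | no u≢v = v , dec-true (v ≟ v) refl , reach u u≢v

module Tournament {n : ℕ} {D : Digraph n} (T : IsTournament D) where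

  private
    loopless : (u : Fin n) → D u u ≡ false
    loopless = proj₁ T

    opposite : (u v : Fin n) → u ≢ v → D u v ≢ D v u
    opposite = proj₂ T

  arc⇒≢ : {u v : Fin n} → D u v ≡ true → u ≢ v
  arc⇒≢ {u} duv refl = contradiction (trans (sym duv) (loopless u)) λ ()

  reverse-arc : {u v : Fin n} → u ≢ v → D u v ≡ false → D v u ≡ true
  reverse-arc {u} {v} u≢v duv = trans (¬-not (opposite v u (≢-sym u≢v))) (cong not duv)

  arc-asymmetric : {u v : Fin n} → D u v ≡ true → D v u ≡ false
  arc-asymmetric {u} {v} duv = trans (¬-not (opposite v u (≢-sym (arc⇒≢ duv)))) (cong not duv)

  inNeighbours-⊂ : {u v : Fin n} → D v u ≡ true →
                   ¬ (∃[ w ] (D u w ≡ true × D w v ≡ true)) →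
                   inNeighbours D v ⊂ inNeighbours D u
  inNeighbours-⊂ {u} {v} dvu ¬twoStep =
    (λ x∈ → ∈-inNeighbours⁺ D (inNeighbour-transfer _ (∈-inNeighbours⁻ D x∈))) ,
    v , ∈-inNeighbours⁺ D dvu , λ v∈ → arc⇒≢ (∈-inNeighbours⁻ D v∈) refl
    where
    inNeighbour-transfer : ∀ x → D x v ≡ true → D x u ≡ true
    inNeighbour-transfer x dxv with x ≟ u | D u x in dux
    ... | yes refl | _     = contradiction (trans (sym dxv) (arc-asymmetric dvu)) λ ()
    ... | no _     | true  = ⊥-elim (¬twoStep (x , dux , dxv))
    ... | no x≢u   | false = reverse-arc (≢-sym x≢u) dux

  maxInDegree⇒inKing : {u v : Fin n} → (∀ x → inDegree D x ≤ inDegree D v) →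
                       D v u ≡ true → ∃[ w ] (D u w ≡ true × D w v ≡ true)
  maxInDegree⇒inKing {u} {v} vmax dvu
    with any? (λ w → (D u w ≟ᵇ true) ×-dec (D w v ≟ᵇ true))
  ... | yes twoStep  = twoStep
  ... | no ¬twoStep = ⊥-elim (<⇒≱ (p⊂q⇒∣p∣<∣q∣ (inNeighbours-⊂ dvu ¬twoStep)) (vmax u))

  rainbowTriangle⇒rainbowPath : {c : Colouring n} → TrianglesRainbow D c →
    {u v w : Fin n} → D u w ≡ true → D w v ≡ true → D v u ≡ true → RainbowPath D c u v
  rainbowTriangle⇒rainbowPath {c} R {u} {v} {w} duw dwv dvu =
    twoArcs⇒rainbowPath c (arc⇒≢ duw) (arc⇒≢ dwv) (≢-sym (arc⇒≢ dvu))
      (proj₁ (R u w v duw dwv dvu)) duw dwv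

  maxInDegree⇒rainbowAbsorbing : {c : Colouring n} → TrianglesRainbow D c →
    {v : Fin n} → (∀ x → inDegree D x ≤ inDegree D v) →
    (u : Fin n) → u ≢ v → RainbowPath D c u v
  maxInDegree⇒rainbowAbsorbing {c} R {v} vmax u u≢v with D u v in duv
  ... | true  = arc⇒rainbowPath c u≢v duv
  ... | false = closeTriangle (maxInDegree⇒inKing vmax dvu)
    where
    dvu : D v u ≡ true
    dvu = reverse-arc u≢v duv

    closeTriangle : ∃[ w ] (D u w ≡ true × D w v ≡ true) → RainbowPath D c u v
    closeTriangle (_ , duw , dwv) = rainbowTriangle⇒rainbowPath R duw dwv dvu

  maxInDegree⇒isKernelByRainbowPaths : {c : Colouring n} → TrianglesRainbow D c →
    {v : Fin n} → (∀ x → inDegree D x ≤ inDegree D v) →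
    IsKernelByRainbowPaths D c (λ x → does (x ≟ v))
  maxInDegree⇒isKernelByRainbowPaths {c} R {v} vmax =
    singleton-isKernelByRainbowPaths c v (maxInDegree⇒rainbowAbsorbing R vmax)

-- With-abstracting over maxInDegree D instead of matching in a helper makes
-- type checking run out of memory.
corollary2 : (n : ℕ) (D : Digraph n) (c : Colouring n) →
    IsTournament D → TrianglesRainbow D c →
    ∃[ S ] IsKernelByRainbowPaths D c S
corollary2 zero    D c T R = (λ ()) , (λ ()) , (λ ())
corollary2 (suc n) D c T R = kernelAt (maxInDegree D)
  where
  kernelAt : ∃[ v ] (∀ u → inDegree D u ≤ inDegree D v) → ∃[ S ] IsKernelByRainbowPaths D c S
  kernelAt (v , vmax) = _ , Tournament.maxInDegree⇒isKernelByRainbowPaths T R vmax
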